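{- Let $d\in\mathbb{Z}$ and let $k$ be a positive integer. The negative polynomial Pell equation $$P^2(X)-(X^{2k}+d)\,Q^2(X)=-1$$ has a non-trivial solution with $P(X),Q(X)\in\mathbb{Z}[X]$ if and only if $d=1$.
   Context: A solution is a pair of polynomials $P(X),Q(X)\in\mathbb{Z}[X]$ satisfying the equation identically; it is non-trivial if $Q(X)\neq 0$. -}

module Defs where

open import Data.Nat using (ℕ; zero; suc; _+_)
open import Data.Integer using (ℤ; 0ℤ; 1ℤ; -1ℤ; +_; -_) renaming (_+_ to _+ℤ_; _*_ to _*ℤ_)
open import Data.List using (List; []; _∷_; map)
open import Data.List.Relation.Unary.All using (All)
open import Relation.Binary.PropositionalEquality using (_≡_)

-- Polynomials in ℤ[X] as coefficient lists, lowest degree first.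
-- Different lists may represent the same polynomial (trailing zeros);
-- equality of polynomials is _≈P_ below.
Poly : Set
Poly = List ℤ

const : ℤ → Poly
const c = c ∷ []

X^_ : ℕ → Poly
X^ zero    = 1ℤ ∷ []
X^ (suc n) = 0ℤ ∷ X^ n

infixl 6 _⊕_ _⊖_
infixl 7 _⊗_ _·_
infix 4 _≈P_
infix 8 X^_

_⊕_ : Poly → Poly → Poly
[]       ⊕ q        = q
(a ∷ p)  ⊕ []       = a ∷ p
(a ∷ p)  ⊕ (b ∷ q)  = (a +ℤ b) ∷ (p ⊕ q)

_·_ : ℤ → Poly → Poly
c · p = map (c *ℤ_) p

⊝_ : Poly → Poly
⊝ p = map -_ p

_⊖_ : Poly → Poly → Poly
p ⊖ q = p ⊕ (⊝ q)

_⊗_ : Poly → Poly → Poly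
[]      ⊗ q = []
(a ∷ p) ⊗ q = (a · q) ⊕ (0ℤ ∷ (p ⊗ q))

IsZeroPoly : Poly → Set
IsZeroPoly p = All (_≡ 0ℤ) p

_≈P_ : Poly → Poly → Set
p ≈P q = IsZeroPoly (p ⊖ q)

IsNegPellSolution : ℕ → ℤ → Poly → Poly → Set
IsNegPellSolution k d P Q =
  (P ⊗ P) ⊖ ((X^ (k + k) ⊕ const d) ⊗ (Q ⊗ Q)) ≈P const -1ℤ

-- Write D = x^(2k) + d and let p² − D q² = c with c ≠ 0 and q of degree n and leading
-- coefficient b. Comparing leading terms, p has degree k + n and, after changing its sign,
-- leading coefficient b. Multiplying p + q √D by x^k − √D, whose norm is −d, gives the
-- solution (x^k p − D q, p − x^k q) of the same equation with c replaced by −d c, and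
-- comparing leading terms in (p − x^k q)(p + x^k q) = d q² + c shows that p − x^k q has
-- smaller degree and leading coefficient d b / 2. The descent ends when p = x^k q, where
-- −d b² = c. Altogether b² d^(J+1) = −c (−4)^J for some J, and for c = −1 this forces d = 1:
-- J odd is impossible by sign, and d (b d^i)² = 16^i rules out d ≠ 1 by sign, mod 3, or size.
-- Polynomials are handled through their functions ℤ → ℤ, so that the ring identities above can
-- be checked pointwise; a polynomial vanishing at every nonzero integer has zero coefficients.

module Submission where

open import Defs
open import Data.Nat using (ℕ; NonZero)
open import Data.Integer using (ℤ; 1ℤ)
open import Data.Product using (∃₂; _×_)
open import Relation.Nullary using (¬_)
open import Relation.Binary.PropositionalEquality using (_≡_)
open import Function.Bundles using (_⇔_)

open import Data.Nat.Base as ℕ using (zero; suc; z≤n; s≤s; _≤_; _<_; ⌊_/2⌋)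
import Data.Nat.Properties as ℕ
open import Data.Nat.DivMod using (_%_; %-distribˡ-*; m%n<n)
open import Data.Nat.Induction using (<-rec)
open import Algebra.Properties.CommutativeSemigroup ℕ.+-commutativeSemigroup using (interchange)
open import Data.Integer.Base using (0ℤ; -1ℤ; +_; -_; _+_; _*_; _-_; _^_; ∣_∣; -[1+_]; ≢-nonZero)
open import Data.Integer.Properties
open import Data.Integer.Tactic.RingSolver using (solve-∀)
open import Data.List.Base using ([]; _∷_; length)
import Data.List.Properties as List
open import Data.List.Relation.Unary.All using ([]; _∷_)
open import Data.Product using (∃-syntax; _,_; proj₁; proj₂)
open import Data.Sum as Sum using (_⊎_; inj₁; inj₂; [_,_]′)
open import Data.Empty using (⊥; ⊥-elim)
open import Relation.Nullary using (yes; no; contradiction)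
open import Relation.Binary.Definitions using (tri<; tri≈; tri>)
open import Relation.Binary.PropositionalEquality
  using (refl; sym; trans; cong; cong₂; subst; _≢_; _≗_; module ≡-Reasoning)
open import Function.Bundles using (mk⇔; module Equivalence)

open ≡-Reasoning

variable
  f g p q r : ℤ → ℤ
  m n N M : ℕ
  a b c : ℤ

eval : Poly → ℤ → ℤ
eval []      x = 0ℤ
eval (a ∷ p) x = a + x * eval p x

eval-⊕ : ∀ p q x → eval (p ⊕ q) x ≡ eval p x + eval q x
eval-⊕ []      q       x = sym (+-identityˡ _)
eval-⊕ (a ∷ p) []      x = sym (+-identityʳ _)
eval-⊕ (a ∷ p) (b ∷ q) x rewrite eval-⊕ p q x = regroup a b x (eval p x) (eval q x)
  where
  regroup : ∀ a b x u v → a + b + x * (u + v) ≡ a + x * u + (b + x * v)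
  regroup = solve-∀

eval-· : ∀ c p x → eval (c · p) x ≡ c * eval p x
eval-· c []      x = sym (*-zeroʳ c)
eval-· c (a ∷ p) x rewrite eval-· c p x = regroup c a x (eval p x)
  where
  regroup : ∀ c a x u → c * a + x * (c * u) ≡ c * (a + x * u)
  regroup = solve-∀

eval-⊝ : ∀ p x → eval (⊝ p) x ≡ - eval p x
eval-⊝ []      x = refl
eval-⊝ (a ∷ p) x rewrite eval-⊝ p x = regroup a x (eval p x)
  where
  regroup : ∀ a x u → - a + x * - u ≡ - (a + x * u)
  regroup = solve-∀

eval-⊖ : ∀ p q x → eval (p ⊖ q) x ≡ eval p x - eval q x
eval-⊖ p q x = trans (eval-⊕ p (⊝ q) x) (cong (_+_ (eval p x)) (eval-⊝ q x))

eval-⊗ : ∀ p q x → eval (p ⊗ q) x ≡ eval p x * eval q x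
eval-⊗ []      q x = refl
eval-⊗ (a ∷ p) q x
  rewrite eval-⊕ (a · q) (0ℤ ∷ (p ⊗ q)) x | eval-· a q x | eval-⊗ p q x =
  regroup a x (eval p x) (eval q x)
  where
  regroup : ∀ a x u v → a * v + (0ℤ + x * (u * v)) ≡ (a + x * u) * v
  regroup = solve-∀

eval-X^ : ∀ n x → eval (X^ n) x ≡ x ^ n
eval-X^ zero    x = cong (_+_ 1ℤ) (*-zeroʳ x)
eval-X^ (suc n) x rewrite eval-X^ n x = +-identityˡ _

eval-const : ∀ c x → eval (const c) x ≡ c
eval-const c x = trans (cong (_+_ c) (*-zeroʳ x)) (+-identityʳ c)

eval-zero : ∀ {p} → IsZeroPoly p → ∀ x → eval p x ≡ 0ℤ
eval-zero []           x = refl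
eval-zero (refl ∷ p≡0) x rewrite eval-zero p≡0 x | *-zeroʳ x = refl

n≡[1+n]*m⇒m≡0 : n ≡ suc n ℕ.* m → m ≡ 0
n≡[1+n]*m⇒m≡0 {m = zero}  _  = refl
n≡[1+n]*m⇒m≡0 {n} {suc m} eq = contradiction (subst (n <_) (sym eq) (ℕ.m≤m*n (suc n) (suc m))) (ℕ.<-irrefl refl)

-- At x = 1 + ∣ b ∣ the term x * y would dominate b unless y = 0.
constant-term≡0 : ∀ b y → b + + suc ∣ b ∣ * y ≡ 0ℤ → b ≡ 0ℤ
constant-term≡0 b y eq = begin
  b              ≡⟨ b≡-sy ⟩
  - (s * y)      ≡⟨ cong (λ t → - (s * t)) y≡0 ⟩
  - (s * 0ℤ)     ≡⟨ cong -_ (*-zeroʳ s) ⟩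
  0ℤ             ∎
  where
  s = + suc ∣ b ∣
  b≡-sy : b ≡ - (s * y)
  b≡-sy = i-j≡0⇒i≡j b (- (s * y)) (trans (cong (_+_ b) (neg-involutive (s * y))) eq)
  y≡0 : y ≡ 0ℤ
  y≡0 = ∣i∣≡0⇒i≡0 (n≡[1+n]*m⇒m≡0 (trans (cong ∣_∣ b≡-sy) (trans (∣-i∣≡∣i∣ (s * y)) (abs-* s y))))

vanishing⇒zero : ∀ p → (∀ x → x ≢ 0ℤ → eval p x ≡ 0ℤ) → IsZeroPoly p
vanishing⇒zero []      _        = []
vanishing⇒zero (b ∷ p) vanishes = b≡0 ∷ vanishing⇒zero p tail-vanishes
  where
  b≡0 : b ≡ 0ℤ
  b≡0 = constant-term≡0 b _ (vanishes (+ suc ∣ b ∣) λ ())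
  tail-vanishes : ∀ x → x ≢ 0ℤ → eval p x ≡ 0ℤ
  tail-vanishes x x≢0 =
    [ (λ x≡0 → contradiction x≡0 x≢0) , (λ p≡0 → p≡0) ]′ (i*j≡0⇒i≡0∨j≡0 x
      (trans (sym (+-identityˡ _)) (subst (λ b → b + x * eval p x ≡ 0ℤ) b≡0 (vanishes x x≢0))))

≈P⇒≗ : ∀ {p q} → p ≈P q → eval p ≗ eval q
≈P⇒≗ {p} {q} p≈q x = i-j≡0⇒i≡j _ _ (trans (sym (eval-⊖ p q x)) (eval-zero p≈q x))

≗⇒≈P : ∀ p q → eval p ≗ eval q → p ≈P q
≗⇒≈P p q p≗q = vanishing⇒zero (p ⊖ q) λ x _ →
  trans (eval-⊖ p q x) (trans (cong (_- eval q x) (p≗q x)) (+-inverseʳ (eval q x)))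

Polynomial : (ℤ → ℤ) → Set
Polynomial f = ∃[ p ] f ≗ eval p

polynomial-const : ∀ c → Polynomial (λ _ → c)
polynomial-const c = const c , λ x → sym (eval-const c x)

polynomial-pow : ∀ n → Polynomial (_^ n)
polynomial-pow n = X^ n , λ x → sym (eval-X^ n x)

polynomial-+ : Polynomial f → Polynomial g → Polynomial (λ x → f x + g x)
polynomial-+ (p , f≗p) (q , g≗q) = p ⊕ q , λ x → trans (cong₂ _+_ (f≗p x) (g≗q x)) (sym (eval-⊕ p q x))

polynomial-* : Polynomial f → Polynomial g → Polynomial (λ x → f x * g x)
polynomial-* (p , f≗p) (q , g≗q) = p ⊗ q , λ x → trans (cong₂ _*_ (f≗p x) (g≗q x)) (sym (eval-⊗ p q x))

polynomial-neg : Polynomial f → Polynomial (λ x → - f x)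
polynomial-neg (p , f≗p) = ⊝ p , λ x → trans (cong -_ (f≗p x)) (sym (eval-⊝ p x))

length-⊕ : ∀ p q → length p ≤ N → length q ≤ N → length (p ⊕ q) ≤ N
length-⊕ []      _       _         len-q     = len-q
length-⊕ (_ ∷ _) []      len-p     _         = len-p
length-⊕ (_ ∷ p) (_ ∷ q) (s≤s len-p) (s≤s len-q) = s≤s (length-⊕ p q len-p len-q)

length-· : ∀ c p → length (c · p) ≡ length p
length-· c = List.length-map (c *_)

length-⊗ : ∀ p q → length (p ⊗ q) ≤ length p ℕ.+ length q
length-⊗ []      q = z≤n
length-⊗ (a ∷ p) q = length-⊕ (a · q) _
  (subst (_≤ _) (sym (length-· a q)) (ℕ.m≤n+m (length q) (suc (length p))))
  (s≤s (length-⊗ p q))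

length-X^ : ∀ n → length (X^ n) ≡ suc n
length-X^ zero    = refl
length-X^ (suc n) = cong suc (length-X^ n)

shift : ℕ → Poly → Poly
shift zero    p = p
shift (suc n) p = 0ℤ ∷ shift n p

length-shift : ∀ n p → length (shift n p) ≡ n ℕ.+ length p
length-shift zero    p = refl
length-shift (suc n) p = cong suc (length-shift n p)

eval-shift : ∀ n p x → eval (shift n p) x ≡ x ^ n * eval p x
eval-shift zero    p x = sym (*-identityˡ _)
eval-shift (suc n) p x = begin
  0ℤ + x * eval (shift n p) x  ≡⟨ +-identityˡ _ ⟩
  x * eval (shift n p) x       ≡⟨ cong (x *_) (eval-shift n p x) ⟩
  x * (x ^ n * eval p x)       ≡⟨ *-assoc x _ _ ⟨
  x * x ^ n * eval p x         ∎

eval-monomial-⊕ : ∀ l a N x → eval (l ⊕ a · X^ N) x ≡ eval l x + a * x ^ N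
eval-monomial-⊕ l a N x =
  trans (eval-⊕ l (a · X^ N) x) (cong (_+_ (eval l x)) (trans (eval-· a (X^ N) x) (cong (a *_) (eval-X^ N x))))

record DegreeAtMost (f : ℤ → ℤ) (N : ℕ) (a : ℤ) : Set where
  constructor degreeAtMost
  field
    rest        : Poly
    rest-length : length rest ≤ N
    split       : ∀ x → f x ≡ eval rest x + a * x ^ N

Degree : (ℤ → ℤ) → ℕ → ℤ → Set
Degree f N a = a ≢ 0ℤ × DegreeAtMost f N a

atMost⇒polynomial : DegreeAtMost f N a → Polynomial f
atMost⇒polynomial {N = N} {a} (degreeAtMost l _ split) =
  l ⊕ a · X^ N , λ x → trans (split x) (sym (eval-monomial-⊕ l a N x))

polynomial⇒atMost : (f≗p : Polynomial f) → DegreeAtMost f (length (proj₁ f≗p)) 0ℤ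
polynomial⇒atMost (p , f≗p) = degreeAtMost p ℕ.≤-refl λ x → trans (f≗p x) (sym (+-identityʳ _))

atMost-cong : f ≗ g → DegreeAtMost f N a → DegreeAtMost g N a
atMost-cong f≗g (degreeAtMost l len split) = degreeAtMost l len λ x → trans (sym (f≗g x)) (split x)

atMost-const : ∀ c → DegreeAtMost (λ _ → c) 0 c
atMost-const c = degreeAtMost [] z≤n λ _ → sym (trans (+-identityˡ _) (*-identityʳ c))

atMost-pow : ∀ n → DegreeAtMost (_^ n) n 1ℤ
atMost-pow n = degreeAtMost [] z≤n λ _ → sym (trans (+-identityˡ _) (*-identityˡ _))

atMost-+ : DegreeAtMost f N a → DegreeAtMost g N b → DegreeAtMost (λ x → f x + g x) N (a + b)
atMost-+ {f} {N} {a} {g} {b} (degreeAtMost l₁ len₁ split₁) (degreeAtMost l₂ len₂ split₂) =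
  degreeAtMost (l₁ ⊕ l₂) (length-⊕ l₁ l₂ len₁ len₂) split
  where
  regroup : ∀ u v a b y → u + a * y + (v + b * y) ≡ u + v + (a + b) * y
  regroup = solve-∀
  split : ∀ x → f x + g x ≡ eval (l₁ ⊕ l₂) x + (a + b) * x ^ N
  split x = begin
    f x + g x                                   ≡⟨ cong₂ _+_ (split₁ x) (split₂ x) ⟩
    eval l₁ x + a * x ^ N + (eval l₂ x + b * x ^ N) ≡⟨ regroup (eval l₁ x) (eval l₂ x) a b (x ^ N) ⟩
    eval l₁ x + eval l₂ x + (a + b) * x ^ N     ≡⟨ cong (_+ (a + b) * x ^ N) (eval-⊕ l₁ l₂ x) ⟨
    eval (l₁ ⊕ l₂) x + (a + b) * x ^ N          ∎

atMost-* : DegreeAtMost f N a → DegreeAtMost g M b → DegreeAtMost (λ x → f x * g x) (N ℕ.+ M) (a * b)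
atMost-* {f} {N} {a} {g} {M} {b} (degreeAtMost l₁ len₁ split₁) (degreeAtMost l₂ len₂ split₂) =
  degreeAtMost rest rest-length split
  where
  rest = (l₁ ⊗ l₂) ⊕ (a · shift N l₂ ⊕ b · shift M l₁)
  length-·shift : ∀ c n l {L} → length l ≤ L → length (c · shift n l) ≤ n ℕ.+ L
  length-·shift c n l len = subst (_≤ _) (sym (trans (length-· c (shift n l)) (length-shift n l))) (ℕ.+-monoʳ-≤ n len)
  rest-length : length rest ≤ N ℕ.+ M
  rest-length = length-⊕ (l₁ ⊗ l₂) _ (ℕ.≤-trans (length-⊗ l₁ l₂) (ℕ.+-mono-≤ len₁ len₂))
    (length-⊕ (a · shift N l₂) (b · shift M l₁) (length-·shift a N l₂ len₂)
      (subst (length (b · shift M l₁) ≤_) (ℕ.+-comm M N) (length-·shift b M l₁ len₁)))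
  eval-rest : ∀ x → eval rest x ≡ eval l₁ x * eval l₂ x + (a * (x ^ N * eval l₂ x) + b * (x ^ M * eval l₁ x))
  eval-rest x = trans (eval-⊕ (l₁ ⊗ l₂) (a · shift N l₂ ⊕ b · shift M l₁) x) (cong₂ _+_ (eval-⊗ l₁ l₂ x)
    (trans (eval-⊕ (a · shift N l₂) (b · shift M l₁) x) (cong₂ _+_
      (trans (eval-· a (shift N l₂) x) (cong (a *_) (eval-shift N l₂ x)))
      (trans (eval-· b (shift M l₁) x) (cong (b *_) (eval-shift M l₁ x))))))
  expand : ∀ u v a b y z → (u + a * y) * (v + b * z) ≡ u * v + (a * (y * v) + b * (z * u)) + a * b * (y * z)
  expand = solve-∀
  split : ∀ x → f x * g x ≡ eval rest x + a * b * x ^ (N ℕ.+ M)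
  split x = begin
    f x * g x
      ≡⟨ cong₂ _*_ (split₁ x) (split₂ x) ⟩
    (eval l₁ x + a * x ^ N) * (eval l₂ x + b * x ^ M)
      ≡⟨ expand (eval l₁ x) (eval l₂ x) a b (x ^ N) (x ^ M) ⟩
    eval l₁ x * eval l₂ x + (a * (x ^ N * eval l₂ x) + b * (x ^ M * eval l₁ x)) + a * b * (x ^ N * x ^ M)
      ≡⟨ cong₂ _+_ (eval-rest x) (cong (a * b *_) (^-distribˡ-+-* x N M)) ⟨
    eval rest x + a * b * x ^ (N ℕ.+ M)
      ∎

atMost-neg : DegreeAtMost f N a → DegreeAtMost (λ x → - f x) N (- a)
atMost-neg {a = a} t = subst (DegreeAtMost _ _) (-1*i≡-i a) (atMost-cong (λ x → -1*i≡-i _) (atMost-* (atMost-const -1ℤ) t))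

atMost-pad : DegreeAtMost f N a → DegreeAtMost f (suc N) 0ℤ
atMost-pad {N = N} {a} t@(degreeAtMost l len _) =
  degreeAtMost (l ⊕ a · X^ N) padded-length λ x → trans (proj₂ (atMost⇒polynomial t) x) (sym (+-identityʳ _))
  where
  padded-length : length (l ⊕ a · X^ N) ≤ suc N
  padded-length = length-⊕ l _ (ℕ.m≤n⇒m≤1+n len) (ℕ.≤-reflexive (trans (length-· a (X^ N)) (length-X^ N)))

atMost-raise : N < M → DegreeAtMost f N a → DegreeAtMost f M 0ℤ
atMost-raise {M = suc M} N<1+M t with ℕ.m≤n⇒m<n∨m≡n (ℕ.s≤s⁻¹ N<1+M)
... | inj₁ N<M  = atMost-pad (atMost-raise N<M t)
... | inj₂ refl = atMost-pad t

split-top : ∀ N l → length l ≤ suc N → ∃[ c ] DegreeAtMost (eval l) N c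
split-top N       []          _         = 0ℤ , degreeAtMost [] z≤n λ _ → refl
split-top zero    (c ∷ [])    _         = c , atMost-cong (λ x → sym (eval-const c x)) (atMost-const c)
split-top zero    (_ ∷ _ ∷ _) (s≤s ())
split-top (suc N) (c ∷ l)     (s≤s len) with split-top N l len
... | a , degreeAtMost l′ len′ split = a , degreeAtMost (c ∷ l′) (s≤s len′) λ x →
  trans (cong (λ t → c + x * t) (split x)) (regroup c x (eval l′ x) a (x ^ N))
  where
  regroup : ∀ c x u a y → c + x * (u + a * y) ≡ c + x * u + a * (x * y)
  regroup = solve-∀

atMost-lower : DegreeAtMost f (suc N) 0ℤ → ∃[ a ] DegreeAtMost f N a
atMost-lower {N = N} (degreeAtMost l len split) =
  let (a , t) = split-top N l len in a , atMost-cong (λ x → sym (trans (split x) (+-identityʳ _))) t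

top-coefficient≡0 : ∀ N l → length l ≤ N → IsZeroPoly (l ⊕ a · X^ N) → a ≡ 0ℤ
top-coefficient≡0 {a} zero    []      _         (a≡0 ∷ []) = trans (sym (*-identityʳ a)) a≡0
top-coefficient≡0     (suc N) []      _         (_ ∷ z)    = top-coefficient≡0 N [] z≤n z
top-coefficient≡0     (suc N) (_ ∷ l) (s≤s len) (_ ∷ z)    = top-coefficient≡0 N l len z

vanishing⇒top≡0 : DegreeAtMost f N a → (∀ x → f x ≡ 0ℤ) → a ≡ 0ℤ
vanishing⇒top≡0 {N = N} t@(degreeAtMost l len _) f≗0 =
  top-coefficient≡0 N l len (vanishing⇒zero _ λ x _ → trans (sym (proj₂ (atMost⇒polynomial t) x)) (f≗0 x))

atMost-unique : DegreeAtMost f N a → DegreeAtMost g N b → f ≗ g → a ≡ b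
atMost-unique {g = g} tf tg f≗g =
  i-j≡0⇒i≡j _ _ (vanishing⇒top≡0 (atMost-+ tf (atMost-neg tg)) λ x → trans (cong (_- g x) (f≗g x)) (+-inverseʳ (g x)))

degree-const : c ≢ 0ℤ → Degree (λ _ → c) 0 c
degree-const c≢0 = c≢0 , atMost-const _

degree-pow : ∀ n → Degree (_^ n) n 1ℤ
degree-pow n = (λ ()) , atMost-pow n

degree-* : Degree f N a → Degree g M b → Degree (λ x → f x * g x) (N ℕ.+ M) (a * b)
degree-* {a = a} (a≢0 , tf) (b≢0 , tg) = (λ ab≡0 → [ a≢0 , b≢0 ]′ (i*j≡0⇒i≡0∨j≡0 a ab≡0)) , atMost-* tf tg

degree-neg : Degree f N a → Degree (λ x → - f x) N (- a)
degree-neg (a≢0 , tf) = (λ -a≡0 → a≢0 (neg-injective -a≡0)) , atMost-neg tf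

degree-+-lower : Degree f N a → DegreeAtMost g M b → M < N → Degree (λ x → f x + g x) N a
degree-+-lower (a≢0 , tf) tg M<N = a≢0 , subst (DegreeAtMost _ _) (+-identityʳ _) (atMost-+ tf (atMost-raise M<N tg))

degree-not-below : Degree f N a → DegreeAtMost g M b → M < N → f ≗ g → ⊥
degree-not-below (a≢0 , tf) tg M<N f≗g = a≢0 (atMost-unique tf (atMost-raise M<N tg) f≗g)

degree-unique : Degree f N a → Degree g M b → f ≗ g → N ≡ M × a ≡ b
degree-unique {N = N} {M = M} df dg f≗g with ℕ.<-cmp N M
... | tri< N<M _ _ = ⊥-elim (degree-not-below dg (proj₂ df) N<M λ x → sym (f≗g x))
... | tri≈ _ refl _ = refl , atMost-unique (proj₂ df) (proj₂ dg) f≗g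
... | tri> _ _ M<N = ⊥-elim (degree-not-below df (proj₂ dg) M<N f≗g)

vanishes-or-degree< : DegreeAtMost f N 0ℤ → (∀ x → f x ≡ 0ℤ) ⊎ ∃₂ λ m a → m < N × Degree f m a
vanishes-or-degree< {N = zero}  (degreeAtMost [] _ split) = inj₁ split
vanishes-or-degree< {N = suc N} t with atMost-lower t
... | a , t′ with a ≟ 0ℤ
...   | no a≢0 = inj₂ (N , a , ℕ.n<1+n N , a≢0 , t′)
...   | yes refl with vanishes-or-degree< t′
...     | inj₁ f≗0                 = inj₁ f≗0
...     | inj₂ (m , a′ , m<N , dm) = inj₂ (m , a′ , ℕ.m<n⇒m<1+n m<N , dm)

even-or-odd : ∀ n → ∃[ i ] (n ≡ i ℕ.+ i ⊎ n ≡ suc (i ℕ.+ i))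
even-or-odd zero    = 0 , inj₁ refl
even-or-odd (suc n) with even-or-odd n
... | i , inj₁ n≡2i   = i , inj₂ (cong suc n≡2i)
... | i , inj₂ n≡2i+1 = suc i , inj₁ (trans (cong suc n≡2i+1) (cong suc (sym (ℕ.+-suc i i))))

square%3 : ∀ n → (n ℕ.* n) % 3 ≡ 0 ⊎ (n ℕ.* n) % 3 ≡ 1
square%3 n with n % 3 | m%n<n n 3 | %-distribˡ-* n n 3
... | 0 | _ | eq = inj₁ eq
... | 1 | _ | eq = inj₂ eq
... | 2 | _ | eq = inj₂ eq
... | suc (suc (suc _)) | s≤s (s≤s (s≤s ())) | _

4^i%3≡1 : ∀ i → (4 ℕ.^ i) % 3 ≡ 1
4^i%3≡1 zero    = refl
4^i%3≡1 (suc i) = trans (%-distribˡ-* 4 (4 ℕ.^ i) 3) (cong (λ t → (1 ℕ.* t) % 3) (4^i%3≡1 i))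

0<[4^i]² : ∀ i → 0 < 4 ℕ.^ i ℕ.* 4 ℕ.^ i
0<[4^i]² i = ℕ.*-mono-≤ (ℕ.m^n>0 4 i) (ℕ.m^n>0 4 i)

[4^i]²%3≡1 : ∀ i → (4 ℕ.^ i ℕ.* 4 ℕ.^ i) % 3 ≡ 1
[4^i]²%3≡1 i = trans (%-distribˡ-* (4 ℕ.^ i) (4 ℕ.^ i) 3) (cong₂ (λ u v → (u ℕ.* v) % 3) (4^i%3≡1 i) (4^i%3≡1 i))

-- Reducing mod 3 rules out D = 0, 2, 3; for D ≥ 4 the left-hand side is too large.
D*Y²≡[4^i]²⇒D≡1 : ∀ D Y i → (4 ≤ D → 4 ℕ.^ i ≤ Y) → D ℕ.* (Y ℕ.* Y) ≡ 4 ℕ.^ i ℕ.* 4 ℕ.^ i → D ≡ 1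
D*Y²≡[4^i]²⇒D≡1 0 Y i _ eq = contradiction (trans (cong (_% 3) eq) ([4^i]²%3≡1 i)) λ ()
D*Y²≡[4^i]²⇒D≡1 1 Y i _ _  = refl
D*Y²≡[4^i]²⇒D≡1 2 Y i _ eq with (Y ℕ.* Y) % 3 | square%3 Y | %-distribˡ-* 2 (Y ℕ.* Y) 3
... | _ | inj₁ refl | mod3 = contradiction (trans (sym mod3) (trans (cong (_% 3) eq) ([4^i]²%3≡1 i))) λ ()
... | _ | inj₂ refl | mod3 = contradiction (trans (sym mod3) (trans (cong (_% 3) eq) ([4^i]²%3≡1 i))) λ ()
D*Y²≡[4^i]²⇒D≡1 3 Y i _ eq =
  contradiction (trans (sym (%-distribˡ-* 3 (Y ℕ.* Y) 3)) (trans (cong (_% 3) eq) ([4^i]²%3≡1 i))) λ ()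
D*Y²≡[4^i]²⇒D≡1 D@(suc (suc (suc (suc _)))) Y i large eq = contradiction eq (ℕ.>⇒≢ (ℕ.<-≤-trans Z<4Z 4Z≤DY²))
  where
  Z = 4 ℕ.^ i ℕ.* 4 ℕ.^ i
  4≤D : 4 ≤ D
  4≤D = s≤s (s≤s (s≤s (s≤s z≤n)))
  Z<4Z : Z < 4 ℕ.* Z
  Z<4Z = ℕ.m<m+n Z (ℕ.<-≤-trans (0<[4^i]² i) (ℕ.m≤m+n Z _))
  4Z≤DY² : 4 ℕ.* Z ≤ D ℕ.* (Y ℕ.* Y)
  4Z≤DY² = ℕ.*-mono-≤ 4≤D (ℕ.*-mono-≤ (large 4≤D) (large 4≤D))

square≡+∣∣² : ∀ x → x * x ≡ + (∣ x ∣ ℕ.* ∣ x ∣)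
square≡+∣∣² (+ n)    = sym (pos-* n n)
square≡+∣∣² -[1+ n ] = refl

abs-^ : ∀ x i → ∣ x ^ i ∣ ≡ ∣ x ∣ ℕ.^ i
abs-^ x zero    = refl
abs-^ x (suc i) = trans (abs-* x (x ^ i)) (cong (∣ x ∣ ℕ.*_) (abs-^ x i))

[-4^i]²≡+[4^i]² : ∀ i → -[1+ 3 ] ^ i * -[1+ 3 ] ^ i ≡ + (4 ℕ.^ i ℕ.* 4 ℕ.^ i)
[-4^i]²≡+[4^i]² i = trans (square≡+∣∣² (-[1+ 3 ] ^ i)) (cong (λ t → + (t ℕ.* t)) (abs-^ -[1+ 3 ] i))

square≢negative : ∀ x n → x * x ≢ -[1+ n ]
square≢negative (+ m)    n eq = contradiction (trans (pos-* m m) eq) λ ()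
square≢negative -[1+ m ] n ()

negative*square≢positive : ∀ n y Z → 0 < Z → -[1+ n ] * (y * y) ≢ + Z
negative*square≢positive n y (suc Z) _ eq with ∣ y ∣ ℕ.* ∣ y ∣ | square≡+∣∣² y
... | zero  | y²≡0 = contradiction (trans (sym (trans (cong (-[1+ n ] *_) y²≡0) (*-zeroʳ -[1+ n ]))) eq) λ ()
... | suc _ | y²≡+ = contradiction (trans (sym (cong (-[1+ n ] *_) y²≡+)) eq) λ ()

d*[bd^i]²≡[-4^i]²⇒d≡1 : ∀ {b d} i → b ≢ 0ℤ →
  d * ((b * d ^ i) * (b * d ^ i)) ≡ -[1+ 3 ] ^ i * -[1+ 3 ] ^ i → d ≡ 1ℤ
d*[bd^i]²≡[-4^i]²⇒d≡1 {b} {+ D} i b≢0 eq = cong +_ (D*Y²≡[4^i]²⇒D≡1 D Y i large (+-injective (begin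
  + (D ℕ.* (Y ℕ.* Y))       ≡⟨ pos-* D _ ⟩
  + D * + (Y ℕ.* Y)         ≡⟨ cong (λ t → + D * + (t ℕ.* t)) ∣y∣≡ ⟨
  + D * + (∣ y ∣ ℕ.* ∣ y ∣) ≡⟨ cong (+ D *_) (square≡+∣∣² y) ⟨
  + D * (y * y)             ≡⟨ eq ⟩
  -[1+ 3 ] ^ i * -[1+ 3 ] ^ i ≡⟨ [-4^i]²≡+[4^i]² i ⟩
  + (4 ℕ.^ i ℕ.* 4 ℕ.^ i)   ∎)))
  where
  y = b * (+ D) ^ i
  Y = ∣ b ∣ ℕ.* D ℕ.^ i
  ∣y∣≡ : ∣ y ∣ ≡ Y
  ∣y∣≡ = trans (abs-* b _) (cong (∣ b ∣ ℕ.*_) (abs-^ (+ D) i))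
  large : 4 ≤ D → 4 ℕ.^ i ≤ Y
  large 4≤D = ℕ.≤-trans (ℕ.^-monoˡ-≤ i 4≤D) (ℕ.m≤n*m (D ℕ.^ i) ∣ b ∣ {{≢-nonZero b≢0}})
d*[bd^i]²≡[-4^i]²⇒d≡1 {b} { -[1+ n ] } i _ eq =
  ⊥-elim (negative*square≢positive n (b * -[1+ n ] ^ i) _ (0<[4^i]² i) (trans eq ([-4^i]²≡+[4^i]² i)))

square≢-4*positive : ∀ x Z → 0 < Z → x * x ≢ -[1+ 3 ] * + Z
square≢-4*positive x (suc Z) _ = square≢negative x _

relation⇒d≡1 : ∀ {b d} J → b ≢ 0ℤ → b * b * d ^ suc J ≡ -[1+ 3 ] ^ J → d ≡ 1ℤ
relation⇒d≡1 {b} {d} J b≢0 eq with even-or-odd J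
... | i , inj₁ refl = d*[bd^i]²≡[-4^i]²⇒d≡1 i b≢0 (begin
  d * ((b * d ^ i) * (b * d ^ i))  ≡⟨ regroup b d (d ^ i) ⟩
  b * b * (d * (d ^ i * d ^ i))    ≡⟨ cong (λ t → b * b * (d * t)) (^-distribˡ-+-* d i i) ⟨
  b * b * d ^ suc (i ℕ.+ i)        ≡⟨ eq ⟩
  -[1+ 3 ] ^ (i ℕ.+ i)             ≡⟨ ^-distribˡ-+-* -[1+ 3 ] i i ⟩
  -[1+ 3 ] ^ i * -[1+ 3 ] ^ i      ∎)
  where
  regroup : ∀ b d t → d * ((b * t) * (b * t)) ≡ b * b * (d * (t * t))
  regroup = solve-∀
... | i , inj₂ refl = ⊥-elim (square≢-4*positive (b * (d * d ^ i)) _ (0<[4^i]² i) (begin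
  (b * (d * d ^ i)) * (b * (d * d ^ i))  ≡⟨ regroup b d (d ^ i) ⟩
  b * b * (d * (d * (d ^ i * d ^ i)))    ≡⟨ cong (λ t → b * b * (d * (d * t))) (^-distribˡ-+-* d i i) ⟨
  b * b * d ^ suc (suc (i ℕ.+ i))        ≡⟨ eq ⟩
  -[1+ 3 ] * -[1+ 3 ] ^ (i ℕ.+ i)        ≡⟨ cong (-[1+ 3 ] *_) (^-distribˡ-+-* -[1+ 3 ] i i) ⟩
  -[1+ 3 ] * (-[1+ 3 ] ^ i * -[1+ 3 ] ^ i) ≡⟨ cong (-[1+ 3 ] *_) ([-4^i]²≡+[4^i]² i) ⟩
  -[1+ 3 ] * + (4 ℕ.^ i ℕ.* 4 ℕ.^ i)     ∎))
  where
  regroup : ∀ b d t → (b * (d * t)) * (b * (d * t)) ≡ b * b * (d * (d * (t * t)))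
  regroup = solve-∀

m+m≡n+n⇒m≡n : m ℕ.+ m ≡ n ℕ.+ n → m ≡ n
m+m≡n+n⇒m≡n {m} {n} eq = trans (ℕ.n≡⌊n+n/2⌋ m) (trans (cong ⌊_/2⌋ eq) (sym (ℕ.n≡⌊n+n/2⌋ n)))

-i*-i≡i*i : ∀ i → - i * - i ≡ i * i
-i*-i≡i*i = solve-∀

i*i≡j*j⇒i≡±j : a * a ≡ b * b → a ≡ b ⊎ a ≡ - b
i*i≡j*j⇒i≡±j {a} {b} eq = Sum.map (i-j≡0⇒i≡j a b)
  (λ a+b≡0 → i-j≡0⇒i≡j a (- b) (trans (cong (_+_ a) (neg-involutive b)) a+b≡0))
  (i*j≡0⇒i≡0∨j≡0 (a - b) (trans (difference-of-squares a b) (trans (cong (_- b * b) eq) (+-inverseʳ (b * b)))))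
  where
  difference-of-squares : ∀ a b → (a - b) * (a + b) ≡ a * a - b * b
  difference-of-squares = solve-∀

module Pell (k : ℕ) (d : ℤ) where

  D : ℤ → ℤ
  D x = x ^ k * x ^ k + d

  -- A record rather than a Π-type, so that c, p and q can be inferred from a solution.
  record PellSolution (c : ℤ) (p q : ℤ → ℤ) : Set where
    constructor pell-solution
    field
      norm≡ : ∀ x → p x * p x - D x * (q x * q x) ≡ c

  open PellSolution

  isNegPellSolution⇔ : ∀ P Q → IsNegPellSolution k d P Q ⇔ PellSolution -1ℤ (eval P) (eval Q)
  isNegPellSolution⇔ P Q = mk⇔
    (λ sol → pell-solution λ x → trans (sym (eval-form x)) (trans (≈P⇒≗ {q = const -1ℤ} sol x) (eval-const -1ℤ x)))
    (λ sol → ≗⇒≈P _ (const -1ℤ) λ x → trans (eval-form x) (trans (norm≡ sol x) (sym (eval-const -1ℤ x))))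
    where
    eval-D : ∀ x → eval (X^ (k ℕ.+ k) ⊕ const d) x ≡ D x
    eval-D x = trans (eval-⊕ (X^ (k ℕ.+ k)) (const d) x)
      (cong₂ _+_ (trans (eval-X^ (k ℕ.+ k) x) (^-distribˡ-+-* x k k)) (eval-const d x))
    eval-form : ∀ x → eval ((P ⊗ P) ⊖ ((X^ (k ℕ.+ k) ⊕ const d) ⊗ (Q ⊗ Q))) x
                    ≡ eval P x * eval P x - D x * (eval Q x * eval Q x)
    eval-form x = trans (eval-⊖ (P ⊗ P) _ x) (cong₂ _-_ (eval-⊗ P P x)
      (trans (eval-⊗ (X^ (k ℕ.+ k) ⊕ const d) (Q ⊗ Q) x) (cong₂ _*_ (eval-D x) (eval-⊗ Q Q x))))

  pell-rearranged : PellSolution c p q → ∀ x → p x * p x ≡ D x * (q x * q x) + c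
  pell-rearranged {p = p} {q} sol x =
    trans (u≡v+[u-v] (p x * p x) (D x * (q x * q x))) (cong (_+_ (D x * (q x * q x))) (norm≡ sol x))
    where
    u≡v+[u-v] : ∀ u v → u ≡ v + (u - v)
    u≡v+[u-v] = solve-∀

  -- descend-p p q − descend-q p q √D = (p + q √D)(x^k − √D), and x^k − √D has norm −d.
  descend-p descend-q : (ℤ → ℤ) → (ℤ → ℤ) → ℤ → ℤ
  descend-p p q x = x ^ k * p x - D x * q x
  descend-q p q x = p x - x ^ k * q x

  descend-solution : PellSolution c p q → PellSolution (- (d * c)) (descend-p p q) (descend-q p q)
  descend-solution {p = p} {q} sol = pell-solution λ x →
    trans (norm-identity (x ^ k) (p x) (q x) d) (cong (λ t → - (d * t)) (norm≡ sol x))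
    where
    norm-identity : ∀ a p q d →
      (a * p - (a * a + d) * q) * (a * p - (a * a + d) * q) - (a * a + d) * ((p - a * q) * (p - a * q))
        ≡ - (d * (p * p - (a * a + d) * (q * q)))
    norm-identity = solve-∀

  descend-q-identity : PellSolution c p q →
    ∀ x → descend-q p q x * (+ 2 * (x ^ k * q x) + descend-q p q x) ≡ d * (q x * q x) + c
  descend-q-identity {p = p} {q} sol x =
    trans (factor (x ^ k) (p x) (q x) d) (cong (_+_ (d * (q x * q x))) (norm≡ sol x))
    where
    factor : ∀ a p q d → (p - a * q) * (+ 2 * (a * q) + (p - a * q)) ≡ d * (q * q) + (p * p - (a * a + d) * (q * q))
    factor = solve-∀

  polynomial-descend-p : Polynomial p → Polynomial q → Polynomial (descend-p p q)
  polynomial-descend-p poly-p poly-q =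
    polynomial-+ (polynomial-* (polynomial-pow k) poly-p) (polynomial-neg (polynomial-* polynomial-D poly-q))
    where
    polynomial-D : Polynomial D
    polynomial-D = polynomial-+ (polynomial-* (polynomial-pow k) (polynomial-pow k)) (polynomial-const d)

  -- Each descent step replaces (b, c) by (d b / 2, −d c); at the bottom −d b² = c.
  LeadingRelation : ℤ → ℤ → Set
  LeadingRelation b c = ∃[ J ] b * b * d ^ suc J ≡ - c * -[1+ 3 ] ^ J

  relation-step : d ≢ 0ℤ → + 2 * a ≡ d * b → LeadingRelation a (- (d * c)) → LeadingRelation b c
  relation-step {a} {b} {c} d≢0 2a≡db (J , rel) = suc J , *-cancelˡ-≡ d _ _ {{≢-nonZero d≢0}} (begin
    d * (b * b * d ^ suc (suc J))        ≡⟨ regroup d b (d ^ J) ⟩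
    (d * b) * (d * b) * d ^ suc J        ≡⟨ cong (λ t → t * t * d ^ suc J) 2a≡db ⟨
    (+ 2 * a) * (+ 2 * a) * d ^ suc J    ≡⟨ factor-4 a (d ^ suc J) ⟩
    + 4 * (a * a * d ^ suc J)            ≡⟨ cong (+ 4 *_) rel ⟩
    + 4 * (- - (d * c) * -[1+ 3 ] ^ J)   ≡⟨ regroup-c d c (-[1+ 3 ] ^ J) ⟩
    d * (- c * -[1+ 3 ] ^ suc J)         ∎)
    where
    regroup : ∀ d b t → d * (b * b * (d * (d * t))) ≡ (d * b) * (d * b) * (d * t)
    regroup = solve-∀
    factor-4 : ∀ a t → (+ 2 * a) * (+ 2 * a) * t ≡ + 4 * (a * a * t)
    factor-4 = solve-∀
    regroup-c : ∀ d c t → + 4 * (- - (d * c) * t) ≡ d * (- c * (-[1+ 3 ] * t))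
    regroup-c = solve-∀

  module _ {{_ : NonZero k}} where

    0<k+ : ∀ n → 0 < k ℕ.+ n
    0<k+ n = ℕ.<-≤-trans (ℕ.>-nonZero⁻¹ k) (ℕ.m≤m+n k n)

    degree-D : Degree D (k ℕ.+ k) 1ℤ
    degree-D = degree-+-lower (degree-* (degree-pow k) (degree-pow k)) (atMost-const d) (0<k+ k)

    0<[k+k]+[n+n] : ∀ n → 0 < (k ℕ.+ k) ℕ.+ (n ℕ.+ n)
    0<[k+k]+[n+n] n = ℕ.<-≤-trans (0<k+ k) (ℕ.m≤m+n (k ℕ.+ k) (n ℕ.+ n))

    pell-rhs-degree : Degree q n b → Degree (λ x → D x * (q x * q x) + c) ((k ℕ.+ k) ℕ.+ (n ℕ.+ n)) (1ℤ * (b * b))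
    pell-rhs-degree {n = n} {c = c} deg-q =
      degree-+-lower (degree-* degree-D (degree-* deg-q deg-q)) (atMost-const c) (0<[k+k]+[n+n] n)

    leading-of-p : Polynomial p → Degree q n b → PellSolution c p q → ∃[ a ] Degree p (k ℕ.+ n) a × a * a ≡ b * b
    leading-of-p {p} {q} {n} {b} poly-p deg-q sol with vanishes-or-degree< (polynomial⇒atMost poly-p)
    ... | inj₁ p≗0 = ⊥-elim (degree-not-below (pell-rhs-degree deg-q) (atMost-const 0ℤ) (0<[k+k]+[n+n] n) λ x →
            trans (sym (pell-rearranged sol x)) (cong (λ t → t * t) (p≗0 x)))
    ... | inj₂ (m , a , _ , deg-p) = a , subst (λ M → Degree p M a) m≡k+n deg-p , trans (proj₂ same) (*-identityˡ _)
      where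
      same : m ℕ.+ m ≡ (k ℕ.+ k) ℕ.+ (n ℕ.+ n) × a * a ≡ 1ℤ * (b * b)
      same = degree-unique (degree-* deg-p deg-p) (pell-rhs-degree deg-q) (pell-rearranged sol)
      m≡k+n : m ≡ k ℕ.+ n
      m≡k+n = m+m≡n+n⇒m≡n (trans (proj₁ same) (interchange k k n n))

    align : Polynomial p → Degree q n b → PellSolution c p q →
            ∃[ p′ ] Polynomial p′ × Degree p′ (k ℕ.+ n) b × PellSolution c p′ q
    align {p} {b = b} poly-p deg-q sol with leading-of-p poly-p deg-q sol
    ... | a , deg-p , a²≡b² with i*i≡j*j⇒i≡±j {a} {b} a²≡b²
    ...   | inj₁ refl = p , poly-p , deg-p , sol
    ...   | inj₂ refl = (λ x → - p x) , polynomial-neg poly-p , subst (Degree _ _) (neg-involutive _) (degree-neg deg-p) ,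
                        pell-solution λ x → trans (cong (_- _) (-i*-i≡i*i (p x))) (norm≡ sol x)

    descend-q-atMost : Degree p (k ℕ.+ n) b → Degree q n b → DegreeAtMost (descend-q p q) (k ℕ.+ n) 0ℤ
    descend-q-atMost {b = b} deg-p deg-q = subst (DegreeAtMost _ _) (trans (cong (λ t → b - t) (*-identityˡ b)) (+-inverseʳ b))
      (atMost-+ (proj₂ deg-p) (atMost-neg (atMost-* (atMost-pow k) (proj₂ deg-q))))

    base-case : c ≢ 0ℤ → Degree q n b → PellSolution c p q → (∀ x → descend-q p q x ≡ 0ℤ) → LeadingRelation b c
    base-case {c} {q} {b = b} c≢0 deg-q sol r≗0 = 0 , (begin
      b * b * (d * 1ℤ)   ≡⟨ regroup b d ⟩
      d * (b * b) * 1ℤ   ≡⟨ cong (_* 1ℤ) db²≡-c ⟩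
      - c * 1ℤ           ∎)
      where
      regroup : ∀ b d → b * b * (d * 1ℤ) ≡ d * (b * b) * 1ℤ
      regroup = solve-∀
      dq²+c≡0 : ∀ x → d * (q x * q x) + c ≡ 0ℤ
      dq²+c≡0 x = trans (sym (descend-q-identity sol x)) (cong (λ t → t * (+ 2 * (x ^ k * q x) + t)) (r≗0 x))
      dq²≡-c : ∀ x → d * (q x * q x) ≡ - c
      dq²≡-c x = i-j≡0⇒i≡j _ _ (trans (cong (_+_ (d * (q x * q x))) (neg-involutive c)) (dq²+c≡0 x))
      d≢0 : d ≢ 0ℤ
      d≢0 d≡0 = c≢0 (neg-injective (sym (trans (sym (cong (_* (q 0ℤ * q 0ℤ)) d≡0)) (dq²≡-c 0ℤ))))
      db²≡-c : d * (b * b) ≡ - c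
      db²≡-c = proj₂ (degree-unique (degree-* (degree-const d≢0) (degree-* deg-q deg-q))
                                    (degree-const λ -c≡0 → c≢0 (neg-injective -c≡0)) dq²≡-c)

    identity-lhs-degree : Degree q n b → Degree r m a → m < k ℕ.+ n →
      Degree (λ x → r x * (+ 2 * (x ^ k * q x) + r x)) (m ℕ.+ (k ℕ.+ n)) (a * (+ 2 * (1ℤ * b)))
    identity-lhs-degree deg-q deg-r m<k+n =
      degree-* deg-r (degree-+-lower (degree-* (degree-const {c = + 2} λ ()) (degree-* (degree-pow k) deg-q)) (proj₂ deg-r) m<k+n)

    0<m+[k+n] : ∀ m n → 0 < m ℕ.+ (k ℕ.+ n)
    0<m+[k+n] m n = ℕ.<-≤-trans (0<k+ n) (ℕ.m≤n+m _ m)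

    descend-q-degree-d≢0 : d ≢ 0ℤ → Degree q n b → Degree r m a → m < k ℕ.+ n →
      (∀ x → r x * (+ 2 * (x ^ k * q x) + r x) ≡ d * (q x * q x) + c) → m < n × + 2 * a ≡ d * b
    descend-q-degree-d≢0 {n = zero} {m = m} {c = c} d≢0 deg-q deg-r m<k+n identity = ⊥-elim (degree-not-below
      (identity-lhs-degree deg-q deg-r m<k+n)
      (atMost-+ (atMost-* (atMost-const d) (atMost-* (proj₂ deg-q) (proj₂ deg-q))) (atMost-const c))
      (0<m+[k+n] m 0) identity)
    descend-q-degree-d≢0 {q} {suc n} {b} {r} {m} {a} {c} d≢0 deg-q deg-r m<k+n identity = m<1+n , 2a≡db
      where
      rhs : Degree (λ x → d * (q x * q x) + c) (suc n ℕ.+ suc n) (d * (b * b))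
      rhs = degree-+-lower (degree-* (degree-const d≢0) (degree-* deg-q deg-q)) (atMost-const c) (s≤s z≤n)
      same = degree-unique (identity-lhs-degree deg-q deg-r m<k+n) rhs identity
      m+k≡1+n : m ℕ.+ k ≡ suc n
      m+k≡1+n = ℕ.+-cancelʳ-≡ (suc n) (m ℕ.+ k) (suc n) (trans (ℕ.+-assoc m k (suc n)) (proj₁ same))
      m<1+n : m < suc n
      m<1+n = subst (m <_) m+k≡1+n (ℕ.m<m+n m (ℕ.>-nonZero⁻¹ k))
      regroup-lhs : ∀ a b → b * (+ 2 * a) ≡ a * (+ 2 * (1ℤ * b))
      regroup-lhs = solve-∀
      regroup-rhs : ∀ b d → d * (b * b) ≡ b * (d * b)
      regroup-rhs = solve-∀
      2a≡db : + 2 * a ≡ d * b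
      2a≡db = *-cancelˡ-≡ b _ _ {{≢-nonZero (proj₁ deg-q)}}
        (trans (regroup-lhs a b) (trans (proj₂ same) (regroup-rhs b d)))

    descend-q-degree : Degree q n b → Degree r m a → m < k ℕ.+ n →
      (∀ x → r x * (+ 2 * (x ^ k * q x) + r x) ≡ d * (q x * q x) + c) → d ≢ 0ℤ × m < n × + 2 * a ≡ d * b
    descend-q-degree {q} {n} {m = m} {c = c} deg-q deg-r m<k+n identity with d ≟ 0ℤ
    ... | yes d≡0 = ⊥-elim (degree-not-below (identity-lhs-degree deg-q deg-r m<k+n) (atMost-const c) (0<m+[k+n] m n) λ x →
                      trans (identity x) (trans (cong (λ t → t * (q x * q x) + c) d≡0) (+-identityˡ c)))
    ... | no d≢0  = d≢0 , descend-q-degree-d≢0 d≢0 deg-q deg-r m<k+n identity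

    Descends : ℕ → Set
    Descends n = ∀ {p q b c} → c ≢ 0ℤ → Polynomial p → Degree q n b → PellSolution c p q → LeadingRelation b c

    descend-further : (∀ {m} → m < n → Descends m) → c ≢ 0ℤ → Polynomial p → Degree q n b → PellSolution c p q →
      Degree (descend-q p q) m a → m < k ℕ.+ n → LeadingRelation b c
    descend-further descends c≢0 poly-p deg-q sol deg-r m<k+n =
      let (d≢0 , m<n , 2a≡db) = descend-q-degree deg-q deg-r m<k+n (descend-q-identity sol)
          -dc≢0 = λ -dc≡0 → [ d≢0 , c≢0 ]′ (i*j≡0⇒i≡0∨j≡0 d (neg-injective -dc≡0))
      in relation-step d≢0 2a≡db (descends m<n -dc≢0
           (polynomial-descend-p poly-p (atMost⇒polynomial (proj₂ deg-q))) deg-r (descend-solution sol))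

    descend-aligned : (∀ {m} → m < n → Descends m) → c ≢ 0ℤ → Degree q n b →
      ∃[ p ] Polynomial p × Degree p (k ℕ.+ n) b × PellSolution c p q → LeadingRelation b c
    descend-aligned descends c≢0 deg-q (_ , poly-p , deg-p , sol) =
      [ base-case c≢0 deg-q sol
      , (λ (_ , _ , m<k+n , deg-r) → descend-further descends c≢0 poly-p deg-q sol deg-r m<k+n)
      ]′ (vanishes-or-degree< (descend-q-atMost deg-p deg-q))

    descent-step : ∀ n → (∀ {m} → m < n → Descends m) → Descends n
    descent-step n descends c≢0 poly-p deg-q sol = descend-aligned descends c≢0 deg-q (align poly-p deg-q sol)

    descent : ∀ n → Descends n
    descent = <-rec Descends descent-step

solvable⇒d≡1 : ∀ {d k} {{_ : NonZero k}} P Q → IsNegPellSolution k d P Q → ¬ IsZeroPoly Q → d ≡ 1ℤ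
solvable⇒d≡1 {d} {k} P Q sol Q≢0 =
  [ (λ Q≗0 → contradiction (vanishing⇒zero Q λ x _ → Q≗0 x) Q≢0)
  , (λ (n , b , _ , deg-Q) →
      let (J , rel) = descent n (λ ()) (P , λ _ → refl) deg-Q (Equivalence.to (isNegPellSolution⇔ P Q) sol)
      in relation⇒d≡1 J (proj₁ deg-Q) (trans rel (*-identityˡ _)))
  ]′ (vanishes-or-degree< (polynomial⇒atMost (Q , λ _ → refl)))
  where
  open Pell k d

unit-solution : ∀ k → ∃₂ λ P Q → IsNegPellSolution k 1ℤ P Q × ¬ IsZeroPoly Q
unit-solution k = X^ k , const 1ℤ , Equivalence.from (isNegPellSolution⇔ (X^ k) (const 1ℤ)) (pell-solution λ x →
  trans (cong₂ (λ u v → u * u - (x ^ k * x ^ k + 1ℤ) * (v * v)) (eval-X^ k x) (eval-const 1ℤ x)) (unit-norm (x ^ k)))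
  , λ { (() ∷ _) }
  where
  open Pell k 1ℤ
  unit-norm : ∀ y → y * y - (y * y + 1ℤ) * (1ℤ * 1ℤ) ≡ -1ℤ
  unit-norm = solve-∀

theorem1p3 : (d : ℤ) (k : ℕ) → NonZero k →
    (∃₂ λ (P Q : Poly) → IsNegPellSolution k d P Q × ¬ IsZeroPoly Q) ⇔ (d ≡ 1ℤ)
theorem1p3 d k k≢0 = mk⇔
  (λ (P , Q , sol , Q≢0) → solvable⇒d≡1 {{k≢0}} P Q sol Q≢0)
  (λ d≡1 → subst (λ d → ∃₂ λ P Q → IsNegPellSolution k d P Q × ¬ IsZeroPoly Q) (sym d≡1) (unit-solution k))
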